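{- If $G$ is a graph with $n(G)\ge 2$, then $2\le \operatorname{mob}(G) \leq \operatorname{gp}(G)$. Moreover, for any $2 \leq a \leq b$ there exists a graph $G$ with $\operatorname{mob}(G) = a$ and $\operatorname{gp}(G) = b$.
   Context: All graphs are connected and simple; $n(G)=|V(G)|$ is the order. A set $S\subseteq V(G)$ is a general position set if no three distinct vertices of $S$ lie on a common shortest path; $\operatorname{gp}(G)$ is the cardinality of a largest general position set of $G$. Place a robot on each vertex of a general position set $S$. Robots move one at a time; a move is legal if the robot moves to an adjacent unoccupied vertex such that the new set of occupied vertices is again in general position. $S$ is a mobile general position set if there is a sequence of legal moves such that every vertex of $G$ is visited by at least one robot. The mobile general position number $\operatorname{mob}(G)$ is the cardinality of a largest mobile general position set of $G$. -}

module Defs where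

open import Data.Nat using (ℕ; zero; suc; _≤_)
open import Data.Fin using (Fin)
open import Data.Fin.Subset using (Subset; _∈_; _∉_; ∣_∣; inside; outside)
open import Data.Vec using (_[_]≔_)
open import Data.List using (List; []; _∷_)
import Data.List.Membership.Propositional as LM
open import Data.Product using (Σ; ∃; _×_; _,_)
open import Data.Sum using (_⊎_)
open import Data.Empty using (⊥)
open import Relation.Nullary using (¬_)
open import Relation.Binary using (Decidable)
open import Relation.Binary.PropositionalEquality using (_≡_)

data Walk {n : ℕ} (R : Fin n → Fin n → Set) : Fin n → Fin n → Set where
  [] : ∀ {u} → Walk R u u
  _∷_ : ∀ {u v w} → R u v → Walk R v w → Walk R u w

len : ∀ {n} {R : Fin n → Fin n → Set} {u v} → Walk R u v → ℕ
len [] = 0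
len (_ ∷ p) = suc (len p)

data OnWalk {n : ℕ} {R : Fin n → Fin n → Set} (x : Fin n) :
            ∀ {u v} → Walk R u v → Set where
  here  : ∀ {v} {p : Walk R x v} → OnWalk x p
  there : ∀ {u v w} {e : R u v} {p : Walk R v w} → OnWalk x p → OnWalk x (e ∷ p)

record Graph : Set₁ where
  field
    n         : ℕ
    Adj       : Fin n → Fin n → Set
    adj?      : Decidable Adj
    sym       : ∀ {u v} → Adj u v → Adj v u
    irrefl    : ∀ {u} → ¬ Adj u u
    connected : ∀ u v → Walk Adj u v
open Graph public

module _ (G : Graph) where

  V : Set
  V = Fin (n G)

  IsShortestPath : ∀ {u v} → Walk (Adj G) u v → Set
  IsShortestPath {u} {v} p = ∀ (q : Walk (Adj G) u v) → len p ≤ len q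

  OnCommonGeodesic : V → V → V → Set
  OnCommonGeodesic x y z =
    Σ V λ u → Σ V λ v → Σ (Walk (Adj G) u v) λ p →
      IsShortestPath p × OnWalk x p × OnWalk y p × OnWalk z p

  GenPos : Subset (n G) → Set
  GenPos S = ∀ x y z → x ∈ S → y ∈ S → z ∈ S →
             ¬ x ≡ y → ¬ y ≡ z → ¬ x ≡ z → ¬ OnCommonGeodesic x y z

  IsGP : ℕ → Set
  IsGP k = (Σ (Subset (n G)) λ S → GenPos S × ∣ S ∣ ≡ k)
         × (∀ S → GenPos S → ∣ S ∣ ≤ k)

  moveTo : Subset (n G) → V → V → Subset (n G)
  moveTo S u v = (S [ u ]≔ outside) [ v ]≔ inside

  data Run : Subset (n G) → Set where
    stop : ∀ S → Run S
    step : ∀ {S} (u v : V) → u ∈ S → v ∉ S → Adj G u v →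
           GenPos (moveTo S u v) → Run (moveTo S u v) → Run S

  Visited : ∀ {S} → Run S → V → Set
  Visited (stop S) x = x ∈ S
  Visited {S} (step u v _ _ _ _ r) x = x ∈ S ⊎ Visited r x

  Mobile : Subset (n G) → Set
  Mobile S = GenPos S × Σ (Run S) λ r → ∀ x → Visited r x

  IsMob : ℕ → Set
  IsMob k = (Σ (Subset (n G)) λ S → Mobile S × ∣ S ∣ ≡ k)
          × (∀ S → Mobile S → ∣ S ∣ ≤ k)

-- Two vertices are always in general position, and two robots can visit every vertex: the
-- active robot walks to its next target, and whenever the other robot blocks the next vertex
-- the two robots exchange roles.
-- For 2 ≤ a ≤ b take the clique K_a with b − a + 1 pendant leaves at one of its vertices, the
-- apex. This graph has diameter 2, so three distinct vertices lie on a common geodesic exactly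
-- when one of them is a common neighbour of the other two and those two are non-adjacent; that
-- common neighbour is always the apex. Hence the b non-apex vertices are in general position,
-- while every larger set contains the apex, a clique vertex and a leaf. A mobile set occupies
-- the apex at some moment, and a general position set containing the apex lies in K_a or
-- consists of the apex and one leaf, so mob ≤ a. Conversely, robots on the a − 1 other clique
-- vertices together with one robot shuttling between the leaves through the apex form a
-- mobile set of size a.
module Submission where

open import Defs hiding (sym)
open import Data.Nat using (ℕ; zero; suc; _+_; _≤_; z≤n; s≤s; s≤s⁻¹)
open import Data.Nat.Properties using (≤-trans; ≤-reflexive; +-suc; m≤n⇒∃[o]m+o≡n; module ≤-Reasoning)
open import Data.Fin using (Fin; zero; suc; _↑ˡ_; _↑ʳ_; splitAt)
open import Data.Fin.Properties using (_≟_; any?; join-splitAt)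
open import Data.Fin.Subset using (Subset; inside; outside; _∈_; _∉_; _⊆_; ∣_∣; ⁅_⁆; ⊤)
  renaming (⊥ to ∅)
open import Data.Fin.Subset.Properties
  using (_∈?_; ∣p∣≤n; p⊆q⇒∣p∣≤∣q∣; ∣⁅x⁆∣≡1; x∈⁅x⁆; x∈⁅y⁆⇒x≡y; x≢y⇒x∉⁅y⁆; ∣⊤∣≡n; ∣⊥∣≡0; ∉⊥)
open import Data.Vec using (Vec; _∷_; _++_; lookup; _[_]≔_; here; there)
open import Data.Vec.Properties
  using ([]≔-updates; []≔-minimal; []≔-idempotent; []≔-lookup; []=⇒lookup; lookup⇒[]=;
         []=-injective; lookup∘updateAt′)
open import Data.List using (List; []; _∷_; allFin)
open import Data.List.Relation.Unary.All using (All; []; _∷_) renaming (map to All-map; lookup to All-lookup)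
open import Data.List.Membership.Propositional.Properties using (∈-allFin)
open import Data.Product using (Σ; _×_; _,_; proj₁; proj₂)
open import Data.Sum using (_⊎_; inj₁; inj₂; swap; [_,_]′)
open import Data.Empty using (⊥; ⊥-elim)
open import Function using (_∘_)
open import Relation.Nullary using (¬_; yes; no)
open import Relation.Nullary.Decidable using (_×-dec_; _⊎-dec_; ¬?)
open import Relation.Binary.PropositionalEquality using (_≡_; _≢_; refl; sym; trans; cong; subst; module ≡-Reasoning)

private
  variable
    m : ℕ

∈-[]≔⁻ : ∀ (p : Subset m) i {s} x → x ∈ p [ i ]≔ s → x ≡ i × s ≡ inside ⊎ x ≢ i × x ∈ p
∈-[]≔⁻ p i x x∈ with x ≟ i
... | yes refl = inj₁ (refl , []=-injective ([]≔-updates p i) x∈)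
... | no x≢i = inj₂ (x≢i , lookup⇒[]= x p (trans (sym (lookup∘updateAt′ x i x≢i p)) ([]=⇒lookup x∈)))

[]≔-restore : ∀ {A : Set} (xs : Vec A m) i {x y} → lookup xs i ≡ x → (xs [ i ]≔ y) [ i ]≔ x ≡ xs
[]≔-restore xs i refl = trans ([]≔-idempotent xs i) ([]≔-lookup xs i)

∈-[]≔outside⁻ : ∀ (p : Subset m) i {x} → x ∈ p [ i ]≔ outside → x ≢ i × x ∈ p
∈-[]≔outside⁻ p i {x} x∈ with ∈-[]≔⁻ p i x x∈
... | inj₁ (_ , ())
... | inj₂ x∈p = x∈p

x∉p⇒lookup≡outside : ∀ {p : Subset m} {x} → x ∉ p → lookup p x ≡ outside
x∉p⇒lookup≡outside {p = p} {x} x∉p with lookup p x in eq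
... | outside = refl
... | inside = ⊥-elim (x∉p (lookup⇒[]= x p eq))

x∉p⇒∣p[x]≔inside∣≡suc∣p∣ : ∀ (p : Subset m) x → x ∉ p → ∣ p [ x ]≔ inside ∣ ≡ suc ∣ p ∣
x∉p⇒∣p[x]≔inside∣≡suc∣p∣ (outside ∷ p) zero    _   = refl
x∉p⇒∣p[x]≔inside∣≡suc∣p∣ (inside ∷ p)  zero    x∉p = ⊥-elim (x∉p here)
x∉p⇒∣p[x]≔inside∣≡suc∣p∣ (outside ∷ p) (suc x) x∉p = x∉p⇒∣p[x]≔inside∣≡suc∣p∣ p x (x∉p ∘ there)
x∉p⇒∣p[x]≔inside∣≡suc∣p∣ (inside ∷ p)  (suc x) x∉p = cong suc (x∉p⇒∣p[x]≔inside∣≡suc∣p∣ p x (x∉p ∘ there))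

x∉p⇒∣p∣≤n : ∀ {m} {p : Subset (suc m)} x → x ∉ p → ∣ p ∣ ≤ m
x∉p⇒∣p∣≤n {m} {p} x x∉p =
  s≤s⁻¹ (subst (_≤ suc m) (x∉p⇒∣p[x]≔inside∣≡suc∣p∣ p x x∉p) (∣p∣≤n (p [ x ]≔ inside)))

∣⊤++⊥∣≡m : ∀ m k → ∣ ⊤ {m} ++ ∅ {k} ∣ ≡ m
∣⊤++⊥∣≡m zero    k = ∣⊥∣≡0 k
∣⊤++⊥∣≡m (suc m) k = cong suc (∣⊤++⊥∣≡m m k)

two-distinct : 2 ≤ m → Σ (Fin m) λ a → Σ (Fin m) λ b → a ≢ b
two-distinct {suc (suc _)} _ = zero , suc zero , λ ()
two-distinct {suc zero} (s≤s ())

↑ˡ∈⊤++⊥ : ∀ {k} (i : Fin m) → (i ↑ˡ k) ∈ ⊤ ++ ∅ {k}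
↑ˡ∈⊤++⊥ zero    = here
↑ˡ∈⊤++⊥ (suc i) = there (↑ˡ∈⊤++⊥ i)

↑ʳ∉⊤++⊥ : ∀ m {k} (t : Fin k) → (m ↑ʳ t) ∉ ⊤ {m} ++ ∅
↑ʳ∉⊤++⊥ zero    t t∈         = ∉⊥ t∈
↑ʳ∉⊤++⊥ (suc m) t (there t∈) = ↑ʳ∉⊤++⊥ m t t∈

pair : Fin m → Fin m → Subset m
pair a b = ⁅ a ⁆ [ b ]≔ inside

∈-pair⁻ : ∀ {a b x : Fin m} → x ∈ pair a b → x ≡ a ⊎ x ≡ b
∈-pair⁻ {a = a} {b} {x} x∈ with ∈-[]≔⁻ ⁅ a ⁆ b x x∈
... | inj₁ (x≡b , _) = inj₂ x≡b
... | inj₂ (_ , x∈⁅a⁆) = inj₁ (x∈⁅y⁆⇒x≡y a x∈⁅a⁆)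

a∈pair : ∀ {a b : Fin m} → a ≢ b → a ∈ pair a b
a∈pair {a = a} {b} a≢b = []≔-minimal ⁅ a ⁆ a b a≢b (x∈⁅x⁆ a)

b∈pair : ∀ (a b : Fin m) → b ∈ pair a b
b∈pair a b = []≔-updates ⁅ a ⁆ b

∣pair∣≡2 : ∀ {a b : Fin m} → a ≢ b → ∣ pair a b ∣ ≡ 2
∣pair∣≡2 {a = a} {b} a≢b =
  trans (x∉p⇒∣p[x]≔inside∣≡suc∣p∣ ⁅ a ⁆ b (x≢y⇒x∉⁅y⁆ (a≢b ∘ sym))) (cong suc (∣⁅x⁆∣≡1 a))

no-three-in-two : ∀ {A : Set} {a b x y z : A} → x ≡ a ⊎ x ≡ b → y ≡ a ⊎ y ≡ b → z ≡ a ⊎ z ≡ b →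
                  x ≢ y → y ≢ z → x ≢ z → ⊥
no-three-in-two (inj₁ refl) (inj₁ refl) _           x≢y _   _   = x≢y refl
no-three-in-two (inj₂ refl) (inj₂ refl) _           x≢y _   _   = x≢y refl
no-three-in-two _           (inj₁ refl) (inj₁ refl) _   y≢z _   = y≢z refl
no-three-in-two _           (inj₂ refl) (inj₂ refl) _   y≢z _   = y≢z refl
no-three-in-two (inj₁ refl) _           (inj₁ refl) _   _   x≢z = x≢z refl
no-three-in-two (inj₂ refl) _           (inj₂ refl) _   _   x≢z = x≢z refl

OneOf₃ : ∀ {A : Set} → A → A → A → A → Set
OneOf₃ u w v x = x ≡ u ⊎ x ≡ w ⊎ x ≡ v

rotate : ∀ {A : Set} {u w v x : A} → OneOf₃ u w v x → OneOf₃ w v u x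
rotate (inj₁ x≡u)        = inj₂ (inj₂ x≡u)
rotate (inj₂ (inj₁ x≡w)) = inj₁ x≡w
rotate (inj₂ (inj₂ x≡v)) = inj₂ (inj₁ x≡v)

three-distinct-cover : ∀ {S : Subset m} {u w v x y z} → x ∈ S → y ∈ S → z ∈ S →
                       x ≢ y → y ≢ z → x ≢ z →
                       OneOf₃ u w v x → OneOf₃ u w v y → OneOf₃ u w v z → u ∈ S × w ∈ S × v ∈ S
three-distinct-cover {S = S} {x = x} {y} {z} x∈ y∈ z∈ x≢y y≢z x≢z ox oy oz =
  first ox oy oz ,
  first (rotate ox) (rotate oy) (rotate oz) ,
  first (rotate (rotate ox)) (rotate (rotate oy)) (rotate (rotate oz))
  where
  first : ∀ {u w v} → OneOf₃ u w v x → OneOf₃ u w v y → OneOf₃ u w v z → u ∈ S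
  first {u} ox oy oz with u ∈? S
  ... | yes u∈ = u∈
  ... | no u∉ = ⊥-elim (no-three-in-two (drop x∈ ox) (drop y∈ oy) (drop z∈ oz) x≢y y≢z x≢z)
    where
    drop : ∀ {t w v} → t ∈ S → OneOf₃ u w v t → t ≡ w ⊎ t ≡ v
    drop t∈ (inj₁ refl) = ⊥-elim (u∉ t∈)
    drop _  (inj₂ o)    = o

module _ {R : Fin m → Fin m → Set} {x : Fin m} where

  onWalk-[] : ∀ {u} → OnWalk {R = R} x {u} [] → x ≡ u
  onWalk-[] here = refl

  onWalk-edge : ∀ {u v} {e : R u v} → OnWalk {R = R} x (e ∷ []) → x ≡ u ⊎ x ≡ v
  onWalk-edge here         = inj₁ refl
  onWalk-edge (there here) = inj₂ refl

  onWalk-path₂ : ∀ {u w v} {e : R u w} {f : R w v} → OnWalk {R = R} x (e ∷ f ∷ []) → OneOf₃ u w v x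
  onWalk-path₂ here                 = inj₁ refl
  onWalk-path₂ (there here)         = inj₂ (inj₁ refl)
  onWalk-path₂ (there (there here)) = inj₂ (inj₂ refl)

module _ (G : Graph) where

  adj⇒≢ : ∀ {u v} → Adj G u v → u ≢ v
  adj⇒≢ e refl = irrefl G e

  Between : V G → V G → V G → Set
  Between a c b = Adj G a c × Adj G c b × ¬ Adj G a b × a ≢ b

  between⇒onCommonGeodesic : ∀ {a c b} → Between a c b → OnCommonGeodesic G a c b
  between⇒onCommonGeodesic {a} {c} {b} (ac , cb , ¬ab , a≢b) =
    a , b , ac ∷ cb ∷ [] , shortest , here , there here , there (there here)
    where
    shortest : (q : Walk (Adj G) a b) → 2 ≤ len q
    shortest []           = ⊥-elim (a≢b refl)
    shortest (ab ∷ [])    = ⊥-elim (¬ab ab)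
    shortest (_ ∷ _ ∷ _) = s≤s (s≤s z≤n)

  shortest₂⇒between : ∀ {a c b} (ac : Adj G a c) (cb : Adj G c b) →
                      IsShortestPath G (ac ∷ cb ∷ []) → Between a c b
  shortest₂⇒between ac cb shortest =
    ac , cb , (λ ab → 2≰1 (shortest (ab ∷ []))) , (λ { refl → 2≰0 (shortest []) })
    where
    2≰1 : ¬ 2 ≤ 1
    2≰1 (s≤s ())
    2≰0 : ¬ 2 ≤ 0
    2≰0 ()

  genPos⇒¬between : ∀ {S a c b} → GenPos G S → a ∈ S → c ∈ S → b ∈ S → ¬ Between a c b
  genPos⇒¬between S-gp a∈ c∈ b∈ btw@(ac , cb , _ , a≢b) =
    S-gp _ _ _ a∈ c∈ b∈ (adj⇒≢ ac) (adj⇒≢ cb) a≢b (between⇒onCommonGeodesic btw)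

  ∈-moveTo⁻ : ∀ {S u v x} → x ∈ moveTo G S u v → x ≡ v ⊎ x ≢ u × x ∈ S
  ∈-moveTo⁻ {S} {u} {v} {x} x∈ with ∈-[]≔⁻ (S [ u ]≔ outside) v x x∈
  ... | inj₁ (x≡v , _) = inj₁ x≡v
  ... | inj₂ (_ , x∈′) = inj₂ (∈-[]≔outside⁻ S u x∈′)

  ∈-moveTo⁺ : ∀ {S u v x} → x ≢ u → x ≢ v → x ∈ S → x ∈ moveTo G S u v
  ∈-moveTo⁺ {S} {u} {v} {x} x≢u x≢v x∈ = []≔-minimal _ x v x≢v ([]≔-minimal S x u x≢u x∈)

  ∣moveTo∣≡∣S∣ : ∀ {S u v} → u ∈ S → v ∉ S → ∣ moveTo G S u v ∣ ≡ ∣ S ∣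
  ∣moveTo∣≡∣S∣ {S} {u} {v} u∈ v∉ = begin
    ∣ S⁻ [ v ]≔ inside ∣  ≡⟨ x∉p⇒∣p[x]≔inside∣≡suc∣p∣ S⁻ v (v∉ ∘ proj₂ ∘ ∈-[]≔outside⁻ S u) ⟩
    suc ∣ S⁻ ∣            ≡⟨ sym (x∉p⇒∣p[x]≔inside∣≡suc∣p∣ S⁻ u (λ u∈S⁻ → proj₁ (∈-[]≔outside⁻ S u u∈S⁻) refl)) ⟩
    ∣ S⁻ [ u ]≔ inside ∣  ≡⟨ cong ∣_∣ ([]≔-restore S u ([]=⇒lookup u∈)) ⟩
    ∣ S ∣                 ∎
    where
    open ≡-Reasoning
    S⁻ : Subset (n G)
    S⁻ = S [ u ]≔ outside

  ∈⇒visited : ∀ {S x} (r : Run G S) → x ∈ S → Visited G r x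
  ∈⇒visited (stop _)             x∈ = x∈
  ∈⇒visited (step _ _ _ _ _ _ _) x∈ = inj₁ x∈

  stepTo : ∀ {S T} u v → moveTo G S u v ≡ T → u ∈ S → v ∉ S → Adj G u v → GenPos G T →
           (r : Run G T) → Σ (Run G S) λ r′ → ∀ {x} → Visited G r x → Visited G r′ x
  stepTo u v refl u∈ v∉ uv T-gp r = step u v u∈ v∉ uv T-gp r , inj₂

  visited⇒reached : ∀ {S x} → GenPos G S → (r : Run G S) → Visited G r x →
                    Σ (Subset (n G)) λ T → GenPos G T × x ∈ T × ∣ T ∣ ≡ ∣ S ∣
  visited⇒reached {S} S-gp (stop _) x∈ = S , S-gp , x∈ , refl
  visited⇒reached {S} S-gp (step _ _ _ _ _ _ _) (inj₁ x∈) = S , S-gp , x∈ , refl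
  visited⇒reached {S} _ (step _ _ u∈ v∉ _ T-gp r) (inj₂ vis) with visited⇒reached T-gp r vis
  ... | T , T-gp′ , x∈ , ∣T∣≡ = T , T-gp′ , x∈ , trans ∣T∣≡ (∣moveTo∣≡∣S∣ u∈ v∉)

  mob≤gp : ∀ {m g} → IsMob G m → IsGP G g → m ≤ g
  mob≤gp {g = g} ((S , (S-gp , _) , ∣S∣≡m) , _) (_ , gp-max) = subst (_≤ g) ∣S∣≡m (gp-max S S-gp)

-- In a graph of diameter at most two a geodesic has at most three vertices, so three distinct
-- vertices on a common geodesic form an induced path.

module DiameterTwo (G : Graph) (diam : ∀ u v → Σ (Walk (Adj G) u v) λ p → len p ≤ 2) where

  genPos-if-no-between : ∀ {S} → (∀ {a c b} → a ∈ S → c ∈ S → b ∈ S → ¬ Between G a c b) → GenPos G S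
  genPos-if-no-between {S} no-between x y z x∈ y∈ z∈ x≢y y≢z x≢z (_ , _ , p , p-shortest , x-on , y-on , z-on) =
    on-geodesic p p-shortest x-on y-on z-on
    where
    on-geodesic : ∀ {u v} (p : Walk (Adj G) u v) → IsShortestPath G p →
                  OnWalk x p → OnWalk y p → OnWalk z p → ⊥
    on-geodesic [] _ x-on y-on _ = x≢y (trans (onWalk-[] x-on) (sym (onWalk-[] y-on)))
    on-geodesic (_ ∷ []) _ x-on y-on z-on =
      no-three-in-two (onWalk-edge x-on) (onWalk-edge y-on) (onWalk-edge z-on) x≢y y≢z x≢z
    on-geodesic (ac ∷ cb ∷ []) p-shortest x-on y-on z-on
      with three-distinct-cover x∈ y∈ z∈ x≢y y≢z x≢z (onWalk-path₂ x-on) (onWalk-path₂ y-on) (onWalk-path₂ z-on)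
    ... | a∈ , c∈ , b∈ = no-between a∈ c∈ b∈ (shortest₂⇒between G ac cb p-shortest)
    on-geodesic {u} {v} (_ ∷ _ ∷ _ ∷ _) p-shortest _ _ _ with diam u v
    ... | q , q≤2 with ≤-trans (p-shortest q) q≤2
    ...   | s≤s (s≤s ())

module TwoRobots (G : Graph) where

  record ExactlyTwo (S : Subset (n G)) (a b : V G) : Set where
    field
      only : ∀ {x} → x ∈ S → x ≡ a ⊎ x ≡ b
      a∈S  : a ∈ S
      b∈S  : b ∈ S
      a≢b  : a ≢ b
  open ExactlyTwo

  exactlyTwo⇒genPos : ∀ {S a b} → ExactlyTwo S a b → GenPos G S
  exactlyTwo⇒genPos S₂ _ _ _ x∈ y∈ z∈ x≢y y≢z x≢z _ =
    no-three-in-two (only S₂ x∈) (only S₂ y∈) (only S₂ z∈) x≢y y≢z x≢z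

  exactlyTwo-swap : ∀ {S a b} → ExactlyTwo S a b → ExactlyTwo S b a
  exactlyTwo-swap S₂ = record { only = swap ∘ only S₂ ; a∈S = b∈S S₂ ; b∈S = a∈S S₂ ; a≢b = a≢b S₂ ∘ sym }

  exactlyTwo-move : ∀ {S c o w} → ExactlyTwo S c o → Adj G c w → w ≢ o →
                    ExactlyTwo (moveTo G S c w) w o × w ∉ S
  exactlyTwo-move {S} {c} {o} {w} S₂ cw w≢o = S₂′ , w∉S
    where
    only′ : ∀ {x} → x ∈ moveTo G S c w → x ≡ w ⊎ x ≡ o
    only′ x∈ with ∈-moveTo⁻ G x∈
    ... | inj₁ x≡w = inj₁ x≡w
    ... | inj₂ (x≢c , x∈S) with only S₂ x∈S
    ...   | inj₁ x≡c = ⊥-elim (x≢c x≡c)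
    ...   | inj₂ x≡o = inj₂ x≡o
    S₂′ : ExactlyTwo (moveTo G S c w) w o
    S₂′ = record
      { only = only′
      ; a∈S = []≔-updates _ w
      ; b∈S = ∈-moveTo⁺ G (a≢b S₂ ∘ sym) (w≢o ∘ sym) (b∈S S₂)
      ; a≢b = w≢o
      }
    w∉S : w ∉ S
    w∉S w∈S with only S₂ w∈S
    ... | inj₁ refl = adj⇒≢ G cw refl
    ... | inj₂ w≡o = w≢o w≡o

  Tour : Subset (n G) → List (V G) → Set
  Tour S ts = Σ (Run G S) λ r → All (Visited G r) ts

  walk-to : ∀ {t ts} → (∀ {S c o} → ExactlyTwo S c o → Tour S ts) →
            ∀ {S c o} → ExactlyTwo S c o → Walk (Adj G) c t → Tour S (t ∷ ts)
  walk-to continue S₂ [] with continue S₂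
  ... | r , visits = r , ∈⇒visited G r (a∈S S₂) ∷ visits
  walk-to continue {o = o} S₂ (_∷_ {v = w} cw p) with w ≟ o
  ... | yes refl = walk-to continue (exactlyTwo-swap S₂) p
  ... | no w≢o with exactlyTwo-move S₂ cw w≢o
  ...   | S₂′ , w∉S =
    let r , visits = walk-to continue S₂′ p
        r′ , r⊆r′ = stepTo G _ w refl (a∈S S₂) w∉S cw (exactlyTwo⇒genPos S₂′) r
    in r′ , All-map r⊆r′ visits

  tour : ∀ ts {S c o} → ExactlyTwo S c o → Tour S ts
  tour []       {S} _  = stop S , []
  tour (t ∷ ts) {c = c} S₂ = walk-to (tour ts) S₂ (connected G c t)

  2≤mob : ∀ {m} → 2 ≤ n G → IsMob G m → 2 ≤ m
  2≤mob 2≤n (_ , mob-max) with two-distinct 2≤n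
  ... | a , b , a≢b = subst (_≤ _) (∣pair∣≡2 a≢b) (mob-max (pair a b) (exactlyTwo⇒genPos pair₂ , r , visits-all))
    where
    pair₂ : ExactlyTwo (pair a b) a b
    pair₂ = record { only = ∈-pair⁻ ; a∈S = a∈pair a≢b ; b∈S = b∈pair a b ; a≢b = a≢b }
    r : Run G (pair a b)
    r = proj₁ (tour (allFin (n G)) pair₂)
    visits-all : ∀ x → Visited G r x
    visits-all x = All-lookup (proj₂ (tour (allFin (n G)) pair₂)) (∈-allFin x)

-- K_a on the apex and the q + 1 vertices of Q, with l + 1 pendant leaves at the apex;
-- so a = q + 2 and b = q + l + 2.

module CliqueWithPendants (q l : ℕ) where

  N : ℕ
  N = suc (suc q + suc l)

  apex : Fin N
  apex = zero

  member : Fin (suc q) → Fin N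
  member i = suc (i ↑ˡ suc l)

  leaf : Fin (suc l) → Fin N
  leaf t = suc (suc q ↑ʳ t)

  Q : Subset N
  Q = outside ∷ (⊤ {suc q} ++ ∅ {suc l})

  apex∉Q : apex ∉ Q
  apex∉Q ()

  member∈Q : ∀ i → member i ∈ Q
  member∈Q i = there (↑ˡ∈⊤++⊥ i)

  leaf∉Q : ∀ t → leaf t ∉ Q
  leaf∉Q t (there t∈) = ↑ʳ∉⊤++⊥ (suc q) t t∈

  leaf≢apex : ∀ t → leaf t ≢ apex
  leaf≢apex t ()

  data Vertex : Fin N → Set where
    isApex   : Vertex apex
    isMember : ∀ i → Vertex (member i)
    isLeaf   : ∀ t → Vertex (leaf t)

  vertex : ∀ x → Vertex x
  vertex zero = isApex
  vertex (suc j) with splitAt (suc q) j | join-splitAt (suc q) (suc l) j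
  ... | inj₁ i | refl = isMember i
  ... | inj₂ t | refl = isLeaf t

  InClique : Fin N → Set
  InClique x = x ≡ apex ⊎ x ∈ Q

  Adjacent : Fin N → Fin N → Set
  Adjacent u v = u ≢ v × (u ≡ apex ⊎ v ≡ apex ⊎ u ∈ Q × v ∈ Q)

  adjacent-sym : ∀ {u v} → Adjacent u v → Adjacent v u
  adjacent-sym (u≢v , inj₁ u≡a)                = u≢v ∘ sym , inj₂ (inj₁ u≡a)
  adjacent-sym (u≢v , inj₂ (inj₁ v≡a))         = u≢v ∘ sym , inj₁ v≡a
  adjacent-sym (u≢v , inj₂ (inj₂ (u∈Q , v∈Q))) = u≢v ∘ sym , inj₂ (inj₂ (v∈Q , u∈Q))

  apex-adjacent : ∀ {x} → x ≢ apex → Adjacent apex x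
  apex-adjacent x≢a = x≢a ∘ sym , inj₁ refl

  adjacent-apex : ∀ {x} → x ≢ apex → Adjacent x apex
  adjacent-apex x≢a = x≢a , inj₂ (inj₁ refl)

  inClique⇒adjacent : ∀ {u v} → u ≢ v → InClique u → InClique v → Adjacent u v
  inClique⇒adjacent u≢v (inj₁ u≡a) _            = u≢v , inj₁ u≡a
  inClique⇒adjacent u≢v (inj₂ _)   (inj₁ v≡a)   = u≢v , inj₂ (inj₁ v≡a)
  inClique⇒adjacent u≢v (inj₂ u∈Q) (inj₂ v∈Q)   = u≢v , inj₂ (inj₂ (u∈Q , v∈Q))

  adjacent⇒apex⊎inClique : ∀ {u w} → Adjacent u w → w ≡ apex ⊎ InClique u
  adjacent⇒apex⊎inClique (_ , inj₁ u≡a)              = inj₂ (inj₁ u≡a)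
  adjacent⇒apex⊎inClique (_ , inj₂ (inj₁ w≡a))       = inj₁ w≡a
  adjacent⇒apex⊎inClique (_ , inj₂ (inj₂ (u∈Q , _))) = inj₂ (inj₂ u∈Q)

  pendant-nonadjacent : ∀ {x y} → x ∉ Q → x ≢ apex → y ≢ apex → ¬ Adjacent x y
  pendant-nonadjacent _   x≢a _   (_ , inj₁ x≡a)              = x≢a x≡a
  pendant-nonadjacent _   _   y≢a (_ , inj₂ (inj₁ y≡a))       = y≢a y≡a
  pendant-nonadjacent x∉Q _   _   (_ , inj₂ (inj₂ (x∈Q , _))) = x∉Q x∈Q

  diam : ∀ u v → Σ (Walk Adjacent u v) λ p → len p ≤ 2
  diam u v with u ≟ v | u ≟ apex | v ≟ apex
  ... | yes refl | _        | _        = [] , z≤n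
  ... | no u≢v   | yes refl | _        = (u≢v , inj₁ refl) ∷ [] , s≤s z≤n
  ... | no u≢v   | no _     | yes refl = (u≢v , inj₂ (inj₁ refl)) ∷ [] , s≤s z≤n
  ... | no _     | no u≢a   | no v≢a   = adjacent-apex u≢a ∷ apex-adjacent v≢a ∷ [] , s≤s (s≤s z≤n)

  G : Graph
  G = record
    { n         = N
    ; Adj       = Adjacent
    ; adj?      = λ u v → ¬? (u ≟ v) ×-dec (u ≟ apex ⊎-dec v ≟ apex ⊎-dec u ∈? Q ×-dec v ∈? Q)
    ; sym       = adjacent-sym
    ; irrefl    = λ uu → proj₁ uu refl
    ; connected = λ u v → proj₁ (diam u v)
    }

  open DiameterTwo G diam

  between⇒middle≡apex : ∀ {u w v} → Between G u w v → w ≡ apex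
  between⇒middle≡apex (uw , wv , ¬uv , u≢v)
    with adjacent⇒apex⊎inClique uw | adjacent⇒apex⊎inClique (adjacent-sym wv)
  ... | inj₁ w≡a | _        = w≡a
  ... | inj₂ _   | inj₁ w≡a = w≡a
  ... | inj₂ u∈K | inj₂ v∈K = ⊥-elim (¬uv (inClique⇒adjacent u≢v u∈K v∈K))

  genPos-without-apex : ∀ {S} → apex ∉ S → GenPos G S
  genPos-without-apex apex∉ =
    genPos-if-no-between λ _ w∈ _ btw → apex∉ (subst (_∈ _) (between⇒middle≡apex btw) w∈)

  -- the robot on t ∉ Q moves while the robots on Q stay put
  Rover : Fin N → Subset N
  Rover t = Q [ t ]≔ inside

  ∈-Rover⁻ : ∀ {t x} → x ∈ Rover t → x ≡ t ⊎ x ∈ Q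
  ∈-Rover⁻ {t} {x} x∈ with ∈-[]≔⁻ Q t x x∈
  ... | inj₁ (x≡t , _) = inj₁ x≡t
  ... | inj₂ (_ , x∈Q) = inj₂ x∈Q

  ∣Rover∣≡2+q : ∀ {t} → t ∉ Q → ∣ Rover t ∣ ≡ suc (suc q)
  ∣Rover∣≡2+q {t} t∉Q = trans (x∉p⇒∣p[x]≔inside∣≡suc∣p∣ Q t t∉Q) (cong suc (∣⊤++⊥∣≡m (suc q) (suc l)))

  genPos-Rover-apex : GenPos G (Rover apex)
  genPos-Rover-apex = genPos-if-no-between λ u∈ _ v∈ (_ , _ , ¬uv , u≢v) →
    ¬uv (inClique⇒adjacent u≢v (∈-Rover⁻ u∈) (∈-Rover⁻ v∈))

  genPos-Rover-leaf : ∀ t → GenPos G (Rover (leaf t))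
  genPos-Rover-leaf t = genPos-without-apex λ apex∈ → [ (λ ()) , apex∉Q ]′ (∈-Rover⁻ {leaf t} apex∈)

  move-Rover : ∀ {t v} → t ∉ Q → moveTo G (Rover t) t v ≡ Rover v
  move-Rover {t} {v} t∉Q = cong (_[ v ]≔ inside) ([]≔-restore Q t (x∉p⇒lookup≡outside t∉Q))

  step-Rover : ∀ {t v} → t ∉ Q → v ∉ Q → Adjacent t v → GenPos G (Rover v) → (r : Run G (Rover v)) →
               Σ (Run G (Rover t)) λ r′ → ∀ {x} → Visited G r x → Visited G r′ x
  step-Rover {t} {v} t∉Q v∉Q tv = stepTo G t v (move-Rover t∉Q) ([]≔-updates Q t) v∉Rover tv
    where
    v∉Rover : v ∉ Rover t
    v∉Rover v∈ = [ (λ v≡t → proj₁ tv (sym v≡t)) , v∉Q ]′ (∈-Rover⁻ v∈)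

  shuttle : ∀ (ts : List (Fin (suc l))) t →
            Σ (Run G (Rover (leaf t))) λ r → Visited G r apex × All (Visited G r ∘ leaf) ts
  shuttle [] t =
    let r , r⊆r′ = step-Rover (leaf∉Q t) apex∉Q (adjacent-apex (leaf≢apex t)) genPos-Rover-apex (stop _)
    in r , r⊆r′ ([]≔-updates Q apex) , []
  shuttle (s ∷ ts) t =
    let r , apex-visited , leaves-visited = shuttle ts s
        r₁ , r⊆r₁ = step-Rover apex∉Q (leaf∉Q s) (apex-adjacent (leaf≢apex s)) (genPos-Rover-leaf s) r
        r₂ , r₁⊆r₂ = step-Rover (leaf∉Q t) apex∉Q (adjacent-apex (leaf≢apex t)) genPos-Rover-apex r₁
    in r₂ , r₁⊆r₂ (r⊆r₁ apex-visited) ,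
       r₁⊆r₂ (r⊆r₁ (∈⇒visited G r ([]≔-updates Q (leaf s)))) ∷ All-map (λ v → r₁⊆r₂ (r⊆r₁ v)) leaves-visited

  mobile-Rover-leaf : Mobile G (Rover (leaf zero))
  mobile-Rover-leaf with shuttle (allFin (suc l)) zero
  ... | r , apex-visited , leaves-visited = genPos-Rover-leaf zero , r , visits-all
    where
    visits-all : ∀ x → Visited G r x
    visits-all x with vertex x
    ... | isApex     = apex-visited
    ... | isMember i = ∈⇒visited G r ([]≔-minimal Q (member i) (leaf zero) member≢leaf (member∈Q i))
      where
      member≢leaf : member i ≢ leaf zero
      member≢leaf eq = leaf∉Q zero (subst (_∈ Q) eq (member∈Q i))
    ... | isLeaf t   = All-lookup leaves-visited (∈-allFin t)

  genPos∋apex⇒∣S∣≤2+q : ∀ {S} → GenPos G S → apex ∈ S → ∣ S ∣ ≤ suc (suc q)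
  genPos∋apex⇒∣S∣≤2+q {S} S-gp apex∈ with any? (λ x → x ∈? S ×-dec ¬? (x ∈? Rover apex))
  ... | no none = ≤-trans (p⊆q⇒∣p∣≤∣q∣ S⊆K) (≤-reflexive (∣Rover∣≡2+q apex∉Q))
    where
    S⊆K : S ⊆ Rover apex
    S⊆K {x} x∈ with x ∈? Rover apex
    ... | yes x∈K = x∈K
    ... | no x∉K = ⊥-elim (none (x , x∈ , x∉K))
  ... | yes (x , x∈ , x∉K) = begin
    ∣ S ∣           ≤⟨ p⊆q⇒∣p∣≤∣q∣ S⊆pair ⟩
    ∣ pair apex x ∣ ≡⟨ ∣pair∣≡2 (x≢apex ∘ sym) ⟩
    2               ≤⟨ s≤s (s≤s z≤n) ⟩
    suc (suc q)     ∎
    where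
    open ≤-Reasoning
    x≢apex : x ≢ apex
    x≢apex refl = x∉K ([]≔-updates Q apex)
    x∉Q : x ∉ Q
    x∉Q x∈Q = x∉K ([]≔-minimal Q x apex x≢apex x∈Q)
    S⊆pair : S ⊆ pair apex x
    S⊆pair {y} y∈ with y ≟ apex | y ≟ x
    ... | yes refl | _ = a∈pair (x≢apex ∘ sym)
    ... | no _ | yes refl = b∈pair apex x
    ... | no y≢apex | no y≢x = ⊥-elim (genPos⇒¬between G S-gp x∈ apex∈ y∈
           (adjacent-apex x≢apex , apex-adjacent y≢apex , pendant-nonadjacent x∉Q x≢apex y≢apex , y≢x ∘ sym))

  isMob : IsMob G (suc (suc q))
  isMob = (Rover (leaf zero) , mobile-Rover-leaf , ∣Rover∣≡2+q (leaf∉Q zero)) , mob-max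
    where
    mob-max : ∀ S → Mobile G S → ∣ S ∣ ≤ suc (suc q)
    mob-max S (S-gp , r , visits) with visited⇒reached G S-gp r (visits apex)
    ... | T , T-gp , apex∈T , ∣T∣≡∣S∣ = subst (_≤ suc (suc q)) ∣T∣≡∣S∣ (genPos∋apex⇒∣S∣≤2+q T-gp apex∈T)

  isGP : IsGP G (suc q + suc l)
  isGP = (outside ∷ ⊤ , genPos-without-apex (λ ()) , ∣⊤∣≡n (suc q + suc l)) , gp-max
    where
    gp-max : ∀ S → GenPos G S → ∣ S ∣ ≤ suc q + suc l
    gp-max S S-gp with apex ∈? S | member zero ∈? S | leaf zero ∈? S
    ... | no apex∉ | _ | _ = x∉p⇒∣p∣≤n apex apex∉
    ... | yes _ | no member∉ | _ = x∉p⇒∣p∣≤n (member zero) member∉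
    ... | yes _ | yes _ | no leaf∉ = x∉p⇒∣p∣≤n (leaf zero) leaf∉
    ... | yes apex∈ | yes member∈ | yes leaf∈ = ⊥-elim (genPos⇒¬between G S-gp leaf∈ apex∈ member∈
          (adjacent-apex (leaf≢apex zero) , apex-adjacent (λ ()) ,
           pendant-nonadjacent (leaf∉Q zero) (leaf≢apex zero) (λ ()) ,
           λ eq → leaf∉Q zero (subst (_∈ Q) (sym eq) (member∈Q zero))))

mob-gp-realizable : ∀ a b → 2 ≤ a → a ≤ b → Σ Graph λ G → IsMob G a × IsGP G b
mob-gp-realizable (suc (suc q)) b (s≤s (s≤s z≤n)) a≤b with m≤n⇒∃[o]m+o≡n a≤b
... | l , refl = G , isMob , subst (IsGP G) (+-suc (suc q) l) isGP
  where open CliqueWithPendants q l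

lemma1p1 : ((G : Graph) → 2 ≤ n G → ∀ (m g : ℕ) → IsMob G m → IsGP G g → 2 ≤ m × m ≤ g)
         × (∀ (a b : ℕ) → 2 ≤ a → a ≤ b → Σ Graph λ G → IsMob G a × IsGP G b)
lemma1p1 = (λ G 2≤n _ _ mob gp → TwoRobots.2≤mob G 2≤n mob , mob≤gp G mob gp) , mob-gp-realizable
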